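{- Let $(I,\rightarrow,0)$ be an implication orthomodular poset and $a\in I$. Then $a'=a\rightarrow 0$ is a singleton.
   Context: An implication orthomodular poset is a triple $(I,\rightarrow,0)$ where $0\in I$ and $\rightarrow$ is a mapping from $I^2$ to the set of nonempty subsets of $I$. Abbreviations: $x':=x\rightarrow0$ and $1:=0'$. Singletons are identified with the element they contain; when a subset appears as an argument of $\rightarrow$ or $'$, the expression is understood elementwise (e.g. $A'=\{a'\mid a\in A\}$), and an equation of the form $A\rightarrow B=1$ for subsets $A,B$ is interpreted by convention (G): for every $a\in A$ there exists $b\in B$ with $a\rightarrow b=1$. The following conditions hold for all $x,y,z\in I$: (O1) $0\rightarrow x=x\rightarrow x=1$; (O2) if $x\rightarrow y=y\rightarrow x=1$ then $x=y$; (O3) if $x\rightarrow y=y\rightarrow z=1$ then $x\rightarrow z=1$; (O4) $x''=x$; (O5) if $x\rightarrow y=1$ then $(y\rightarrow z)\rightarrow(x\rightarrow z)=1$; (O6) if $x\rightarrow y=1$ then $(((y'\rightarrow x)\rightarrow x)'\rightarrow x)\rightarrow x=y$; (O7) if $x\rightarrow y'=1$ then $x\rightarrow((x\rightarrow y)\rightarrow y)=y\rightarrow((x\rightarrow y)\rightarrow y)=1$; (O8) if $x\rightarrow y'=x\rightarrow z=y\rightarrow z=1$ then $((x\rightarrow y)\rightarrow y)\rightarrow z=1$; (O9) $(x'\rightarrow x)\rightarrow x=1$; (O10) $x\rightarrow(y\rightarrow x)=1$. -}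

module Defs where

open import Level using (Level; _⊔_; suc)
open import Data.Product using (Σ; ∃; _×_; _,_)
open import Relation.Binary.PropositionalEquality using (_≡_)
open import Function.Bundles using (_⇔_)

SubsetOf : ∀ {a} (ℓ : Level) → Set a → Set (a ⊔ suc ℓ)
SubsetOf ℓ I = I → Set ℓ

⟦_⟧ : ∀ {a ℓ} {I : Set a} → I → SubsetOf (a ⊔ ℓ) I
⟦_⟧ {ℓ = ℓ} x c = Level.Lift ℓ (c ≡ x)

module _ {a : Level} {I : Set a} where

  infix 4 _≐_
  _≐_ : ∀ {ℓ₁ ℓ₂} → SubsetOf ℓ₁ I → SubsetOf ℓ₂ I → Set (a ⊔ ℓ₁ ⊔ ℓ₂)
  A ≐ B = ∀ c → A c ⇔ B c

  IsSingleton : ∀ {ℓ₁} → SubsetOf ℓ₁ I → Set (a ⊔ ℓ₁)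
  IsSingleton A = ∃ λ b → ∀ c → A c ⇔ (c ≡ b)

record IOMP {a ℓ : Level} (I : Set a) : Set (a ⊔ suc ℓ) where
  field
    _↝_      : I → I → SubsetOf ℓ I
    𝟘        : I
    nonempty : ∀ x y → ∃ λ z → (x ↝ y) z

  infixr 10 _⇒_
  _⇒_ : ∀ {ℓ₁ ℓ₂} → SubsetOf ℓ₁ I → SubsetOf ℓ₂ I → SubsetOf (a ⊔ ℓ ⊔ ℓ₁ ⊔ ℓ₂) I
  (A ⇒ B) c = ∃ λ x → ∃ λ y → A x × B y × (x ↝ y) c

  -- singletons identified with their element
  ⌜_⌝ : I → SubsetOf (a ⊔ ℓ) I
  ⌜ x ⌝ = ⟦_⟧ {ℓ = ℓ} x

  _′ : I → SubsetOf ℓ I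
  x ′ = x ↝ 𝟘

  _′ˢ : ∀ {ℓ₁} → SubsetOf ℓ₁ I → SubsetOf (a ⊔ ℓ ⊔ ℓ₁) I
  A ′ˢ = A ⇒ ⌜ 𝟘 ⌝

  𝟙 : SubsetOf ℓ I
  𝟙 = 𝟘 ′

  -- convention (G): "A → B = 1" means ∀ a ∈ A ∃ b ∈ B, a → b = 1
  G𝟙 : ∀ {ℓ₁ ℓ₂} → SubsetOf ℓ₁ I → SubsetOf ℓ₂ I → Set (a ⊔ ℓ ⊔ ℓ₁ ⊔ ℓ₂)
  G𝟙 A B = ∀ x → A x → ∃ λ y → B y × ((x ↝ y) ≐ 𝟙)

  field
    O1a : ∀ x → (𝟘 ↝ x) ≐ 𝟙
    O1b : ∀ x → (x ↝ x) ≐ 𝟙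
    O2  : ∀ x y → (x ↝ y) ≐ 𝟙 → (y ↝ x) ≐ 𝟙 → x ≡ y
    O3  : ∀ x y z → (x ↝ y) ≐ 𝟙 → (y ↝ z) ≐ 𝟙 → (x ↝ z) ≐ 𝟙
    O4  : ∀ x → ((x ′) ′ˢ) ≐ ⌜ x ⌝
    O5  : ∀ x y z → (x ↝ y) ≐ 𝟙 → G𝟙 (y ↝ z) (x ↝ z)
    O6  : ∀ x y → (x ↝ y) ≐ 𝟙 →
            (((((((y ′) ⇒ ⌜ x ⌝) ⇒ ⌜ x ⌝) ′ˢ) ⇒ ⌜ x ⌝) ⇒ ⌜ x ⌝) ≐ ⌜ y ⌝)
    O7a : ∀ x y → G𝟙 ⌜ x ⌝ (y ′) → G𝟙 ⌜ x ⌝ ((x ↝ y) ⇒ ⌜ y ⌝)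
    O7b : ∀ x y → G𝟙 ⌜ x ⌝ (y ′) → G𝟙 ⌜ y ⌝ ((x ↝ y) ⇒ ⌜ y ⌝)
    O8  : ∀ x y z → G𝟙 ⌜ x ⌝ (y ′) → (x ↝ z) ≐ 𝟙 → (y ↝ z) ≐ 𝟙 →
            G𝟙 ((x ↝ y) ⇒ ⌜ y ⌝) ⌜ z ⌝
    O9  : ∀ x → G𝟙 ((x ′) ⇒ ⌜ x ⌝) ⌜ x ⌝
    O10 : ∀ x y → G𝟙 ⌜ x ⌝ (y ↝ x)

-- Negation is a total multivalued map with x'' = {x}. Any such map is
-- single-valued: if b ∈ x' then some element of b' exists and equals x, so
-- x ∈ b'; hence every c ∈ x' lies in b'' = {b}.
module Submission where

open import Level using (Level; lift; lower)
open import Defs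
open import Data.Product using (∃; _,_)
open import Relation.Binary.PropositionalEquality using (_≡_; refl)
open import Function.Bundles using (Equivalence; mk⇔)

module _ {a ℓ : Level} {I : Set a} (f : I → SubsetOf ℓ I)
         (total : ∀ x → ∃ (f x))
         (f∘f⊆id : ∀ {x y z} → f x y → f y z → z ≡ x) where

  ∈-inverse : ∀ {x y} → f x y → f y x
  ∈-inverse {y = y} fxy with total y
  ... | z , fyz with f∘f⊆id fxy fyz
  ...   | refl = fyz

  self-inverse⇒singleton : ∀ x → IsSingleton (f x)
  self-inverse⇒singleton x with total x
  ... | b , fxb = b , λ c → mk⇔ (λ fxc → f∘f⊆id (∈-inverse fxb) fxc) λ { refl → fxb }

module _ {a ℓ : Level} {I : Set a} (P : IOMP {a} {ℓ} I) where
  open IOMP P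

  ′-′-⊆-id : ∀ {x y z} → (x ′) y → (y ′) z → z ≡ x
  ′-′-⊆-id {x} {y} {z} x′y y′z =
    lower (Equivalence.to (O4 x z) (y , 𝟘 , x′y , lift refl , y′z))

lemma2p4 : ∀ {a ℓ : Level} {I : Set a} (P : IOMP {a} {ℓ} I) (x : I) →
    IsSingleton (IOMP._′ P x)
lemma2p4 P = self-inverse⇒singleton _′ (λ x → nonempty x 𝟘) (′-′-⊆-id P)
  where open IOMP P
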